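{- Let $\mathbf{F}=(F,\leq_\mathbf{F})$ be the countable universal homogeneous echeloned space. Then every metric $d$ on $F$ that induces $\leq_\mathbf{F}$ (i.e. $(x_1,y_1)\leq_\mathbf{F}(x_2,y_2)\iff d(x_1,y_1)\leq d(x_2,y_2)$) is dull; consequently $(F,d)$ is bounded and uniformly discrete.
   Context: An echeloned space is a pair $(X,\leq_\mathbf{X})$ where $X$ is a non-empty set and $\leq_\mathbf{X}$ is a total preorder on $X^2$ such that for all $x,y,z$: $(x,x)\leq_\mathbf{X}(y,z)$; $(y,z)\leq_\mathbf{X}(x,x)$ implies $y=z$; $(x,y)\leq_\mathbf{X}(y,x)$. Embeddings are injective maps $h$ with $(x_1,y_1)\leq_\mathbf{X}(x_2,y_2)\iff(h(x_1),h(y_1))\leq_\mathbf{Y}(h(x_2),h(y_2))$. $\mathbf{F}$ is the Fraïssé limit of the class of finite echeloned spaces: the unique countable echeloned space that is homogeneous (isomorphisms between finite substructures extend to automorphisms) and into which every finite echeloned space embeds. A metric space $(X,d)$ is dull if $d(x,x')\leq d(y,y')+d(z,z')$ for all $x,x',y,y',z,z'$ with $y\neq y'$, $z\neq z'$; it is uniformly discrete if nonzero distances are bounded below by a positive constant. -}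

module Defs where

open import Level using (0ℓ)
open import Data.Nat using (ℕ; suc)
open import Data.Fin using (Fin)
open import Data.Product using (_×_; _,_; Σ; ∃)
open import Data.Sum using (_⊎_)
open import Relation.Nullary using (¬_)
open import Relation.Binary.PropositionalEquality using (_≡_; _≢_)
open import Relation.Binary.Core using (Rel)
open import Relation.Binary.Structures using (IsTotalPreorder)
open import Algebra.Structures using (IsCommutativeRing)
open import Function.Definitions using (Injective)
open import Function.Bundles using (_⇔_)

-- The real numbers, axiomatised as a complete ordered field.
-- (agda-stdlib has no reals; every complete ordered field is isomorphic
-- to ℝ, so quantifying over all of them is faithful.)

record CompleteOrderedField : Set₁ where
  infixl 6 _+_
  infixl 7 _*_
  infix  4 _≤_ _<_
  field
    Carrier : Set
    _+_ _*_ : Carrier → Carrier → Carrier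
    -_      : Carrier → Carrier
    0# 1#   : Carrier
    isCommutativeRing : IsCommutativeRing _≡_ _+_ _*_ -_ 0# 1#
    0≢1     : 0# ≢ 1#
    inverse : ∀ x → x ≢ 0# → Σ Carrier λ y → x * y ≡ 1#
    _≤_     : Rel Carrier 0ℓ
    ≤-refl  : ∀ {x} → x ≤ x
    ≤-trans : ∀ {x y z} → x ≤ y → y ≤ z → x ≤ z
    ≤-antisym : ∀ {x y} → x ≤ y → y ≤ x → x ≡ y
    ≤-total : ∀ x y → x ≤ y ⊎ y ≤ x
    +-mono-≤ : ∀ {x y} z → x ≤ y → x + z ≤ y + z
    *-nonneg : ∀ {x y} → 0# ≤ x → 0# ≤ y → 0# ≤ x * y
    sup : (S : Carrier → Set) → (∃ λ s → S s) →
          (∃ λ b → ∀ s → S s → s ≤ b) →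
          Σ Carrier λ u → (∀ s → S s → s ≤ u) ×
                          (∀ b → (∀ s → S s → s ≤ b) → u ≤ b)

  _<_ : Rel Carrier 0ℓ
  x < y = x ≤ y × x ≢ y

record EcheloneSpace : Set₁ where
  infix 4 _≼_
  field
    Carrier : Set
    _≼_     : Rel (Carrier × Carrier) 0ℓ
    isTotalPreorder : IsTotalPreorder _≡_ _≼_
    nonEmpty : Carrier
    diag-least : ∀ x y z → (x , x) ≼ (y , z)
    diag-only  : ∀ x y z → (y , z) ≼ (x , x) → y ≡ z
    sym-≼      : ∀ x y → (x , y) ≼ (y , x)

open EcheloneSpace

IsEmbedding : (X Y : EcheloneSpace) → (Carrier X → Carrier Y) → Set
IsEmbedding X Y h =
  Injective _≡_ _≡_ h ×
  (∀ x₁ y₁ x₂ y₂ → _≼_ X (x₁ , y₁) (x₂ , y₂) ⇔ _≼_ Y (h x₁ , h y₁) (h x₂ , h y₂))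

IsFinite : EcheloneSpace → Set
IsFinite X = Σ ℕ λ n → Σ (Carrier X → Fin n) λ f → Σ (Fin n → Carrier X) λ g →
  (∀ x → g (f x) ≡ x) × (∀ i → f (g i) ≡ i)

IsCountable : EcheloneSpace → Set
IsCountable X = Σ (Carrier X → ℕ) λ f → Injective _≡_ _≡_ f

IsUniversal : EcheloneSpace → Set₁
IsUniversal F = (X : EcheloneSpace) → IsFinite X → Σ (Carrier X → Carrier F) (IsEmbedding X F)

IsAutomorphism : (F : EcheloneSpace) → (Carrier F → Carrier F) → Set
IsAutomorphism F σ = IsEmbedding F F σ × (∀ y → Σ (Carrier F) λ x → σ x ≡ y)

-- homogeneity: an isomorphism between finite substructures
-- {f i} → {g i} (i.e. the map f i ↦ g i, f, g injective, which
-- preserves and reflects ≼) extends to an automorphism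
IsHomogeneous : EcheloneSpace → Set
IsHomogeneous F = (n : ℕ) (f g : Fin n → Carrier F) →
  Injective _≡_ _≡_ f → Injective _≡_ _≡_ g →
  (∀ i j k l → _≼_ F (f i , f j) (f k , f l) ⇔ _≼_ F (g i , g j) (g k , g l)) →
  Σ (Carrier F → Carrier F) λ σ → IsAutomorphism F σ × (∀ i → σ (f i) ≡ g i)

IsFraisseLimit : EcheloneSpace → Set₁
IsFraisseLimit F = IsCountable F × IsUniversal F × IsHomogeneous F

module _ (R : CompleteOrderedField) where
  open CompleteOrderedField R renaming (Carrier to ℝ)

  record IsMetric {A : Set} (d : A → A → ℝ) : Set where
    field
      zero⇔eq : ∀ x y → d x y ≡ 0# ⇔ x ≡ y
      symmetric : ∀ x y → d x y ≡ d y x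
      triangle : ∀ x y z → d x z ≤ d x y + d y z

  Induces : (X : EcheloneSpace) → (Carrier X → Carrier X → ℝ) → Set
  Induces X d = ∀ x₁ y₁ x₂ y₂ → _≼_ X (x₁ , y₁) (x₂ , y₂) ⇔ d x₁ y₁ ≤ d x₂ y₂

  IsDull : {A : Set} → (A → A → ℝ) → Set
  IsDull {A} d = ∀ (x x' y y' z z' : A) → y ≢ y' → z ≢ z' → d x x' ≤ d y y' + d z z'

  IsBounded : {A : Set} → (A → A → ℝ) → Set
  IsBounded {A} d = Σ ℝ λ M → ∀ (x y : A) → d x y ≤ M

  IsUniformlyDiscrete : {A : Set} → (A → A → ℝ) → Set
  IsUniformlyDiscrete {A} d = Σ ℝ λ ε → (0# < ε) × (∀ (x y : A) → x ≢ y → ε ≤ d x y)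

-- Given x ≠ x', y ≠ y' and z ≠ z', the finite substructure of F on these six points
-- extends (as an abstract echeloned space) by a point w with (w , y) at the level of
-- (x , x') and (w , y') at the level of (z , z'); universality and homogeneity realise
-- this extension inside F. Since d induces the echelon, d(x,x') = d(w,y) and
-- d(z,z') = d(w,y'), so the triangle inequality gives
-- d(x,x') ≤ d(w,y') + d(y',y) = d(z,z') + d(y,y').
-- Fixing distinct points p, q, dullness bounds every distance by 2 d(p,q) and every
-- nonzero distance from below by d(p,q) / 2.

module Submission where

open import Level using (0ℓ)
open import Defs
open import Data.Product using (_×_; _,_; Σ; ∃; ∃₂; proj₁; proj₂; swap)
open import Data.Sum using (_⊎_; inj₁; inj₂)
open import Data.Empty using (⊥-elim)
open import Data.Nat using (ℕ; suc)
open import Data.Nat.Properties using (eq?)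
open import Data.Fin using (Fin; zero; suc)
open import Data.Fin.Properties using (0≢1+n; suc-injective) renaming (_≟_ to _≟ᶠ_)
open import Data.List using (List; []; _∷_; length; lookup; deduplicate)
open import Data.List.Membership.Propositional using (_∈_)
open import Data.List.Membership.Propositional.Properties using (∈-lookup; ∈-deduplicate⁺)
open import Data.List.Relation.Unary.All as All using (All)
open import Data.List.Relation.Unary.Any using (here; there; index)
open import Data.List.Relation.Unary.Any.Properties using (lookup-index)
open import Data.List.Relation.Unary.AllPairs using (_∷_)
open import Data.List.Relation.Unary.Unique.Propositional using (Unique)
open import Data.List.Relation.Unary.Unique.DecPropositional.Properties using (deduplicate-!)
open import Relation.Nullary using (yes; no)
open import Relation.Binary.Definitions using (DecidableEquality)
open import Relation.Binary.PropositionalEquality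
open import Relation.Binary.Structures using (IsTotalPreorder)
open import Function.Base using (_∘_)
open import Function.Bundles using (_⇔_; Equivalence; mk↣)
open import Function.Definitions using (Injective)
import Function.Properties.Equivalence as ⇔
open import Algebra.Bundles using (CommutativeRing)
import Algebra.Properties.Ring as RingProperties

open Equivalence using (to; from)

module OrderedFieldProperties (R : CompleteOrderedField) where
  open CompleteOrderedField R
  commutativeRing : CommutativeRing 0ℓ 0ℓ
  commutativeRing = record { isCommutativeRing = isCommutativeRing }

  open CommutativeRing commutativeRing
    using (ring; +-comm; +-identityˡ; -‿inverseʳ; *-identityʳ; *-comm; *-assoc; distribˡ)
  open RingProperties ring using (-1*x≈-x; -‿involutive; +-cancelʳ)

  ≤-reflexive : ∀ {a b} → a ≡ b → a ≤ b
  ≤-reflexive refl = ≤-refl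

  +-mono₂-≤ : ∀ {a b c e} → a ≤ b → c ≤ e → a + c ≤ b + e
  +-mono₂-≤ {a} {b} {c} {e} a≤b c≤e = ≤-trans (+-mono-≤ c a≤b)
    (≤-trans (≤-reflexive (+-comm b c)) (≤-trans (+-mono-≤ b c≤e) (≤-reflexive (+-comm e b))))

  +-nonneg : ∀ {a b} → 0# ≤ a → 0# ≤ b → 0# ≤ a + b
  +-nonneg 0≤a 0≤b = ≤-trans (≤-reflexive (sym (+-identityˡ 0#))) (+-mono₂-≤ 0≤a 0≤b)

  -- If 1 ≤ 0 then 0 ≤ -1, and so 0 ≤ (-1) * (-1) = 1.
  0≤1 : 0# ≤ 1#
  0≤1 with ≤-total 0# 1#
  ... | inj₁ 0≤1 = 0≤1
  ... | inj₂ 1≤0 = ≤-trans (*-nonneg 0≤-1 0≤-1)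
                     (≤-reflexive (trans (-1*x≈-x (- 1#)) (-‿involutive 1#)))
    where
    0≤-1 : 0# ≤ - 1#
    0≤-1 = ≤-trans (≤-reflexive (sym (-‿inverseʳ 1#)))
             (≤-trans (+-mono-≤ (- 1#) 1≤0) (≤-reflexive (+-identityˡ (- 1#))))

  1+1≢0 : 1# + 1# ≢ 0#
  1+1≢0 2≡0 = 0≢1 (≤-antisym 0≤1 (≤-trans (≤-reflexive (sym (+-identityˡ 1#)))
                                    (≤-trans (+-mono-≤ 1# 0≤1) (≤-reflexive 2≡0))))

  half : ∀ a → ∃ λ e → e + e ≡ a
  half a = a * ½ , (begin
      a * ½ + a * ½             ≡⟨ cong₂ _+_ (*-identityʳ (a * ½)) (*-identityʳ (a * ½)) ⟨
      a * ½ * 1# + a * ½ * 1#   ≡⟨ distribˡ (a * ½) 1# 1# ⟨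
      a * ½ * (1# + 1#)         ≡⟨ *-assoc a ½ (1# + 1#) ⟩
      a * (½ * (1# + 1#))       ≡⟨ cong (a *_) (trans (*-comm ½ (1# + 1#)) ½-inverse) ⟩
      a * 1#                    ≡⟨ *-identityʳ a ⟩
      a                         ∎)
    where
    open ≡-Reasoning
    ½ = proj₁ (inverse (1# + 1#) 1+1≢0)
    ½-inverse = proj₂ (inverse (1# + 1#) 1+1≢0)

  +-double-cancel-≤ : ∀ {e t} → e + e ≤ t + t → e ≤ t
  +-double-cancel-≤ {e} {t} e+e≤t+t with ≤-total e t
  ... | inj₁ e≤t = e≤t
  ... | inj₂ t≤e = ≤-reflexive (sym (+-cancelʳ e t e (≤-antisym t+e≤e+e e+e≤t+e)))
    where
    t+e≤e+e : t + e ≤ e + e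
    t+e≤e+e = +-mono-≤ e t≤e
    e+e≤t+e : e + e ≤ t + e
    e+e≤t+e = ≤-trans e+e≤t+t (≤-trans (+-mono-≤ t t≤e) (≤-reflexive (+-comm e t)))

  +-double-nonneg : ∀ {t} → 0# ≤ t + t → 0# ≤ t
  +-double-nonneg 0≤t+t = +-double-cancel-≤ (≤-trans (≤-reflexive (+-identityˡ 0#)) 0≤t+t)

  half-pos : ∀ {a e} → e + e ≡ a → 0# < a → 0# < e
  half-pos e+e≡a (0≤a , 0≢a) =
    +-double-nonneg (≤-trans 0≤a (≤-reflexive (sym e+e≡a))) ,
    λ { refl → 0≢a (trans (sym (+-identityˡ 0#)) e+e≡a) }

module MetricProperties (R : CompleteOrderedField) {A : Set}
  (d : A → A → CompleteOrderedField.Carrier R) (metric : IsMetric R d) where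
  open CompleteOrderedField R
  open OrderedFieldProperties R
  open IsMetric metric

  d-nonneg : ∀ x y → 0# ≤ d x y
  d-nonneg x y = +-double-nonneg (≤-trans (≤-reflexive (sym (from (zero⇔eq x x) refl)))
    (≤-trans (triangle x y x) (≤-reflexive (cong (d x y +_) (symmetric y x)))))

  module _ (dull : IsDull R d) {p q : A} (p≢q : p ≢ q) where

    dull⇒bounded : IsBounded R d
    dull⇒bounded = d p q + d p q , λ x y → dull x y p q p q p≢q p≢q

    dull⇒uniformlyDiscrete : IsUniformlyDiscrete R d
    dull⇒uniformlyDiscrete = ε ,
      half-pos ε+ε≡dpq (d-nonneg p q , λ 0≡dpq → p≢q (to (zero⇔eq p q) (sym 0≡dpq))) ,
      λ x y x≢y → +-double-cancel-≤ (≤-trans (≤-reflexive ε+ε≡dpq) (dull p q x y x y x≢y x≢y))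
      where
      ε = proj₁ (half (d p q))
      ε+ε≡dpq = proj₂ (half (d p q))

lookup-injective : ∀ {A : Set} {xs : List A} → Unique xs → Injective _≡_ _≡_ (lookup xs)
lookup-injective {xs = x ∷ xs} _ {zero}  {zero}  _ = refl
lookup-injective {xs = x ∷ xs} (x∉xs ∷ _) {zero}  {suc j} x≡xⱼ = ⊥-elim (All.lookup x∉xs (∈-lookup j) x≡xⱼ)
lookup-injective {xs = x ∷ xs} (x∉xs ∷ _) {suc i} {zero}  xᵢ≡x = ⊥-elim (All.lookup x∉xs (∈-lookup i) (sym xᵢ≡x))
lookup-injective {xs = x ∷ xs} (_ ∷ unique) {suc i} {suc j} xᵢ≡xⱼ = cong suc (lookup-injective unique xᵢ≡xⱼ)

record Enumeration {A : Set} (xs : List A) : Set where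
  field
    size : ℕ
    point : Fin size → A
    point-injective : Injective _≡_ _≡_ point
    position : ∀ {x} → x ∈ xs → Fin size
    point-position : ∀ {x} (x∈xs : x ∈ xs) → point (position x∈xs) ≡ x

enumerate : ∀ {A : Set} → DecidableEquality A → (xs : List A) → Enumeration xs
enumerate _≟_ xs = record
  { size = length (deduplicate _≟_ xs)
  ; point = lookup (deduplicate _≟_ xs)
  ; point-injective = lookup-injective (deduplicate-! _≟_ xs)
  ; position = index ∘ ∈-deduplicate⁺ _≟_
  ; point-position = sym ∘ lookup-index ∘ ∈-deduplicate⁺ _≟_
  }

module EchelonProperties (X : EcheloneSpace) where
  open EcheloneSpace X
  private module ≼ = IsTotalPreorder isTotalPreorder

  infix 4 _≋_
  _≋_ : Carrier × Carrier → Carrier × Carrier → Set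
  p ≋ q = p ≼ q × q ≼ p

  IsDiagonal : Carrier × Carrier → Set
  IsDiagonal (x , y) = x ≡ y

  diagonal-least : ∀ {p} q → IsDiagonal p → p ≼ q
  diagonal-least {x , .x} (y , z) refl = diag-least x y z

  diagonal-only : ∀ {p q} → IsDiagonal q → p ≼ q → IsDiagonal p
  diagonal-only {y , z} {x , .x} refl = diag-only x y z

  pullback : (C : Set) → C → (L : C × C → Carrier × Carrier) →
             (∀ a → IsDiagonal (L (a , a))) →
             (∀ a b → IsDiagonal (L (a , b)) → a ≡ b) →
             (∀ a b → L (b , a) ≡ swap (L (a , b))) →
             EcheloneSpace
  pullback C c L L-diagonal L-reflects-diagonal L-swap = record
    { Carrier = C
    ; _≼_ = λ p q → L p ≼ L q
    ; isTotalPreorder = record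
      { isPreorder = record
        { isEquivalence = isEquivalence
        ; reflexive = λ { refl → ≼.refl }
        ; trans = ≼.trans }
      ; total = λ p q → ≼.total (L p) (L q) }
    ; nonEmpty = c
    ; diag-least = λ x y z → diagonal-least (L (y , z)) (L-diagonal x)
    ; diag-only = λ x y z → L-reflects-diagonal y z ∘ diagonal-only (L-diagonal x)
    ; sym-≼ = λ x y → subst (L (x , y) ≼_) (sym (L-swap x y)) (sym-≼ _ _) }

discrete : (A : Set) → DecidableEquality A → A → EcheloneSpace
discrete A _≟_ a = record
  { Carrier = A
  ; _≼_ = _≼_
  ; isTotalPreorder = record
    { isPreorder = record { isEquivalence = isEquivalence ; reflexive = reflexive ; trans = ≼-trans }
    ; total = total }
  ; nonEmpty = a
  ; diag-least = λ _ _ _ → inj₁ refl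
  ; diag-only = λ { _ _ _ (inj₁ y≡z) → y≡z ; _ _ _ (inj₂ x≢x) → ⊥-elim (x≢x refl) }
  ; sym-≼ = sym-≼ }
  where
  _≼_ : A × A → A × A → Set
  (i , j) ≼ (k , l) = i ≡ j ⊎ k ≢ l

  reflexive : ∀ {p q} → p ≡ q → p ≼ q
  reflexive {i , j} refl with i ≟ j
  ... | yes i≡j = inj₁ i≡j
  ... | no i≢j = inj₂ i≢j

  ≼-trans : ∀ {p q r} → p ≼ q → q ≼ r → p ≼ r
  ≼-trans (inj₁ i≡j) _ = inj₁ i≡j
  ≼-trans (inj₂ k≢l) (inj₁ k≡l) = ⊥-elim (k≢l k≡l)
  ≼-trans (inj₂ _) (inj₂ m≢n) = inj₂ m≢n

  total : ∀ p q → p ≼ q ⊎ q ≼ p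
  total (i , j) _ with i ≟ j
  ... | yes i≡j = inj₁ (inj₁ i≡j)
  ... | no i≢j = inj₂ (inj₂ i≢j)

  sym-≼ : ∀ x y → (x , y) ≼ (y , x)
  sym-≼ x y with x ≟ y
  ... | yes x≡y = inj₁ x≡y
  ... | no x≢y = inj₂ (x≢y ∘ sym)

module FraisseLimitProperties (F : EcheloneSpace)
  (universal : IsUniversal F) (homogeneous : IsHomogeneous F) where
  open EcheloneSpace F
  open EchelonProperties F
  private module ≼ = IsTotalPreorder isTotalPreorder

  two-distinct-points : ∃₂ λ (p q : Carrier) → p ≢ q
  two-distinct-points = h zero , h (suc zero) , 0≢1+n ∘ h-injective
    where
    two = discrete (Fin 2) _≟ᶠ_ zero
    embedding = universal two (2 , (λ i → i) , (λ i → i) , (λ _ → refl) , (λ _ → refl))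
    h = proj₁ embedding
    h-injective = proj₁ (proj₂ embedding)

  -- Universality embeds B somewhere, and homogeneity moves the copy of the substructure onto A.
  extend-embedding : (B : EcheloneSpace) → IsFinite B → ∀ {n}
    (ι : Fin n → EcheloneSpace.Carrier B) → Injective _≡_ _≡_ ι →
    (A : Fin n → Carrier) → Injective _≡_ _≡_ A →
    (∀ i j k l → EcheloneSpace._≼_ B (ι i , ι j) (ι k , ι l) ⇔ (A i , A j) ≼ (A k , A l)) →
    Σ (EcheloneSpace.Carrier B → Carrier) λ e → IsEmbedding B F e × (∀ i → e (ι i) ≡ A i)
  extend-embedding B finite {n} ι ι-injective A A-injective ι≅A =
    σ ∘ h , (h-injective ∘ σ-injective , λ a b c e → ⇔.trans (h-embeds a b c e) (σ-embeds _ _ _ _)) , σ-moves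
    where
    embedding = universal B finite
    h = proj₁ embedding
    h-injective = proj₁ (proj₂ embedding)
    h-embeds = proj₂ (proj₂ embedding)
    automorphism = homogeneous n (h ∘ ι) A (ι-injective ∘ h-injective) A-injective
      λ i j k l → ⇔.trans (⇔.sym (h-embeds (ι i) (ι j) (ι k) (ι l))) (ι≅A i j k l)
    σ = proj₁ automorphism
    σ-injective = proj₁ (proj₁ (proj₁ (proj₂ automorphism)))
    σ-embeds = proj₂ (proj₁ (proj₁ (proj₂ automorphism)))
    σ-moves = proj₂ (proj₂ automorphism)

  realise : ∀ {n} (A : Fin n → Carrier) → Injective _≡_ _≡_ A →
    (ν : Fin n → Fin n × Fin n) → (∀ j → proj₁ (ν j) ≢ proj₂ (ν j)) →
    ∃ λ w → ∀ j → (w , A j) ≋ (A (proj₁ (ν j)) , A (proj₂ (ν j)))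
  realise {n} A A-injective ν ν-off-diagonal = e zero , w-realises
    where
    -- Adjoin to A a point zero with (zero , suc j) placed at the level of ν j.
    L : Fin (suc n) × Fin (suc n) → Carrier × Carrier
    L (zero  , zero)  = nonEmpty , nonEmpty
    L (zero  , suc j) = A (proj₁ (ν j)) , A (proj₂ (ν j))
    L (suc i , zero)  = swap (L (zero , suc i))
    L (suc i , suc j) = A i , A j

    L-diagonal : ∀ a → IsDiagonal (L (a , a))
    L-diagonal zero = refl
    L-diagonal (suc i) = refl

    L-reflects-diagonal : ∀ a b → IsDiagonal (L (a , b)) → a ≡ b
    L-reflects-diagonal zero    zero    _ = refl
    L-reflects-diagonal zero    (suc j) p = ⊥-elim (ν-off-diagonal j (A-injective p))
    L-reflects-diagonal (suc i) zero    p = ⊥-elim (ν-off-diagonal i (A-injective (sym p)))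
    L-reflects-diagonal (suc i) (suc j) p = cong suc (A-injective p)

    L-swap : ∀ a b → L (b , a) ≡ swap (L (a , b))
    L-swap zero    zero    = refl
    L-swap zero    (suc j) = refl
    L-swap (suc i) zero    = refl
    L-swap (suc i) (suc j) = refl

    B = pullback (Fin (suc n)) zero L L-diagonal L-reflects-diagonal L-swap
    extension = extend-embedding B (suc n , (λ i → i) , (λ i → i) , (λ _ → refl) , (λ _ → refl))
                  suc suc-injective A A-injective (λ _ _ _ _ → ⇔.refl)
    e = proj₁ extension
    e-embeds = proj₂ (proj₁ (proj₂ extension))
    e-extends = proj₂ (proj₂ extension)

    w-realises : ∀ j → (e zero , A j) ≋ (A (proj₁ (ν j)) , A (proj₂ (ν j)))
    w-realises j rewrite sym (e-extends j) | sym (e-extends (proj₁ (ν j))) | sym (e-extends (proj₂ (ν j))) =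
      to (e-embeds zero (suc j) (suc a) (suc b)) ≼.refl ,
      to (e-embeds (suc a) (suc b) zero (suc j)) ≼.refl
      where
      a = proj₁ (ν j)
      b = proj₂ (ν j)

  common-apex : DecidableEquality Carrier → ∀ {x x' y y' z z'} → x ≢ x' → y ≢ y' → z ≢ z' →
    ∃ λ w → (w , y) ≋ (x , x') × (w , y') ≋ (z , z')
  common-apex _≟_ {x} {x'} {y} {y'} {z} {z'} x≢x' y≢y' z≢z' =
    w , realised-at y∈ x∈ x'∈ ν-at-y , realised-at y'∈ z∈ z'∈ ν-at-y'
    where
    points = y ∷ y' ∷ x ∷ x' ∷ z ∷ z' ∷ []
    y∈  = here refl
    y'∈ = there (here refl)
    x∈  = there (there (here refl))
    x'∈ = there (there (there (here refl)))
    z∈  = there (there (there (there (here refl))))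
    z'∈ = there (there (there (there (there (here refl)))))

    open Enumeration (enumerate _≟_ points) renaming (point to A; point-position to at)

    ν : Fin size → Fin size × Fin size
    ν j with j ≟ᶠ position y∈
    ... | yes _ = position x∈ , position x'∈
    ... | no _ = position z∈ , position z'∈

    ν-off-diagonal : ∀ j → proj₁ (ν j) ≢ proj₂ (ν j)
    ν-off-diagonal j with j ≟ᶠ position y∈
    ... | yes _ = λ i≡i' → x≢x' (trans (sym (at x∈)) (trans (cong A i≡i') (at x'∈)))
    ... | no _ = λ i≡i' → z≢z' (trans (sym (at z∈)) (trans (cong A i≡i') (at z'∈)))

    ν-at-y : ν (position y∈) ≡ (position x∈ , position x'∈)
    ν-at-y with position y∈ ≟ᶠ position y∈
    ... | yes _ = refl
    ... | no i≢i = ⊥-elim (i≢i refl)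

    ν-at-y' : ν (position y'∈) ≡ (position z∈ , position z'∈)
    ν-at-y' with position y'∈ ≟ᶠ position y∈
    ... | yes i'≡i = ⊥-elim (y≢y' (trans (sym (at y∈)) (trans (cong A (sym i'≡i)) (at y'∈))))
    ... | no _ = refl

    apex = realise A point-injective ν ν-off-diagonal
    w = proj₁ apex

    realised-at : ∀ {p q r} (p∈ : p ∈ points) (q∈ : q ∈ points) (r∈ : r ∈ points) →
      ν (position p∈) ≡ (position q∈ , position r∈) → (w , p) ≋ (q , r)
    realised-at p∈ q∈ r∈ ν-at-p = subst₂ _≋_ (cong (w ,_) (at p∈))
      (trans (cong (λ ij → A (proj₁ ij) , A (proj₂ ij)) ν-at-p) (cong₂ _,_ (at q∈) (at r∈)))
      (proj₂ apex (position p∈))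

module InducedMetric (R : CompleteOrderedField) (X : EcheloneSpace)
  (d : EcheloneSpace.Carrier X → EcheloneSpace.Carrier X → CompleteOrderedField.Carrier R)
  (metric : IsMetric R d) (induces : Induces R X d) where
  open CompleteOrderedField R
  open EchelonProperties X
  open OrderedFieldProperties R
  open MetricProperties R d metric
  open IsMetric metric
  open CommutativeRing commutativeRing using (+-comm)

  ≋⇒d-≡ : ∀ {x y x' y'} → (x , y) ≋ (x' , y') → d x y ≡ d x' y'
  ≋⇒d-≡ (xy≼x'y' , x'y'≼xy) = ≤-antisym (to (induces _ _ _ _) xy≼x'y') (to (induces _ _ _ _) x'y'≼xy)

  -- The triangle inequality in w, y', y, where d w y = d x x' and d w y' = d z z'.
  dull-of-common-apexes :
    (∀ {x x' y y' z z'} → x ≢ x' → y ≢ y' → z ≢ z' → ∃ λ w → (w , y) ≋ (x , x') × (w , y') ≋ (z , z')) →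
    DecidableEquality (EcheloneSpace.Carrier X) → IsDull R d
  dull-of-common-apexes common-apex _≟_ x x' y y' z z' y≢y' z≢z' with x ≟ x'
  ... | yes refl = ≤-trans (≤-reflexive (from (zero⇔eq x x) refl)) (+-nonneg (d-nonneg y y') (d-nonneg z z'))
  ... | no x≢x' with common-apex x≢x' y≢y' z≢z'
  ...   | w , wy≋xx' , wy'≋zz' = ≤-trans (≤-reflexive (sym (≋⇒d-≡ wy≋xx')))
    (≤-trans (triangle w y' y)
      (≤-reflexive (trans (cong₂ _+_ (≋⇒d-≡ wy'≋zz') (symmetric y' y)) (+-comm (d z z') (d y y')))))

proposition3p5 : (R : CompleteOrderedField) (F : EcheloneSpace) → IsFraisseLimit F →
    (d : EcheloneSpace.Carrier F → EcheloneSpace.Carrier F → CompleteOrderedField.Carrier R) →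
    IsMetric R d → Induces R F d →
    IsDull R d × IsBounded R d × IsUniformlyDiscrete R d
proposition3p5 R F (countable , universal , homogeneous) d metric induces =
  dull , dull⇒bounded dull p≢q , dull⇒uniformlyDiscrete dull p≢q
  where
  open FraisseLimitProperties F universal homogeneous
  open InducedMetric R F d metric induces
  open MetricProperties R d metric

  _≟_ : DecidableEquality (EcheloneSpace.Carrier F)
  _≟_ = eq? (mk↣ (proj₂ countable))

  dull : IsDull R d
  dull = dull-of-common-apexes (common-apex _≟_) _≟_

  p≢q = proj₂ (proj₂ two-distinct-points)
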